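{- Every connected cobipartite graph $G$ with at least two vertices has a spanning even tree, except when $G$ is isomorphic to the complete graph on two vertices, to a path on four vertices, or to a cycle on four vertices.
   Context: All graphs are finite and simple. A cobipartite graph is the complement of a bipartite graph. A leaf of a tree is a vertex of degree $1$. A tree is even if for every pair of distinct leaves, the number of edges of the unique path between them is even. A spanning even tree of $G$ is a spanning tree of $G$ that is even. -}

module Defs where

open import Data.Bool using (Bool; true; false; not; _∨_; if_then_else_)
open import Data.Nat using (ℕ; zero; suc; _≤_; ∣_-_∣; _≡ᵇ_) renaming (_+_ to _+ℕ_)
open import Data.Nat.Properties using (∣-∣-comm; ∣n-n∣≡0)
open import Data.Fin using (Fin; toℕ)
open import Data.List using (List; []; _∷_; map; allFin)
open import Data.Nat.ListAction using (sum)
open import Data.List.Relation.Unary.Unique.Propositional using (Unique)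
open import Data.Product using (Σ; _×_)
open import Function.Bundles using (_⤖_; Bijection)
open import Relation.Binary.PropositionalEquality using (_≡_; _≢_; refl; cong)
open import Relation.Nullary using (¬_)

record Graph (n : ℕ) : Set where
  field
    adj    : Fin n → Fin n → Bool
    sym    : ∀ u v → adj u v ≡ adj v u
    irrefl : ∀ u → adj u u ≡ false
open Graph public

data Walk {n : ℕ} (G : Graph n) : Fin n → Fin n → Set where
  []  : ∀ {u} → Walk G u u
  _∷_ : ∀ {u w v} → adj G u w ≡ true → Walk G w v → Walk G u v

len : ∀ {n} {G : Graph n} {u v} → Walk G u v → ℕ
len []       = 0
len (_ ∷ p)  = suc (len p)

verts : ∀ {n} {G : Graph n} {u v} → Walk G u v → List (Fin n)
verts {u = u} []      = u ∷ []
verts {u = u} (_ ∷ p) = u ∷ verts p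

IsPath : ∀ {n} {G : Graph n} {u v} → Walk G u v → Set
IsPath p = Unique (verts p)

-- vertices of a closed walk without the repeated starting vertex
cycVerts : ∀ {n} {G : Graph n} {u v} → Walk G u v → List (Fin n)
cycVerts []      = []
cycVerts (_ ∷ p) = verts p

IsCycle : ∀ {n} {G : Graph n} {u} → Walk G u u → Set
IsCycle c = (3 ≤ len c) × Unique (cycVerts c)

Connected : ∀ {n} → Graph n → Set
Connected G = ∀ u v → Walk G u v

Acyclic : ∀ {n} → Graph n → Set
Acyclic G = ∀ u (c : Walk G u u) → ¬ IsCycle c

IsTree : ∀ {n} → Graph n → Set
IsTree T = Connected T × Acyclic T

degree : ∀ {n} → Graph n → Fin n → ℕ
degree {n} G u = sum (map (λ v → if adj G u v then 1 else 0) (allFin n))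

IsLeaf : ∀ {n} → Graph n → Fin n → Set
IsLeaf G u = degree G u ≡ 1

Even : ℕ → Set
Even k = Σ ℕ (λ m → k ≡ m +ℕ m)

IsEvenTree : ∀ {n} → Graph n → Set
IsEvenTree T = IsTree T ×
  (∀ u v → u ≢ v → IsLeaf T u → IsLeaf T v →
     (p : Walk T u v) → IsPath p → Even (len p))

SpanningSub : ∀ {n} → Graph n → Graph n → Set
SpanningSub T G = ∀ u v → adj T u v ≡ true → adj G u v ≡ true

HasSpanningEvenTree : ∀ {n} → Graph n → Set
HasSpanningEvenTree {n} G = Σ (Graph n) (λ T → SpanningSub T G × IsEvenTree T)

Bipartite : ∀ {n} → Graph n → Set
Bipartite {n} H = Σ (Fin n → Bool) (λ c → ∀ u v → adj H u v ≡ true → c u ≢ c v)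

complement : ∀ {n} → Graph n → Graph n
complement G = record
  { adj    = λ u v → not (eqF u v ∨ adj G u v)
  ; sym    = λ u v → cong₂' (eqF-sym u v) (Graph.sym G u v)
  ; irrefl = λ u → irr u
  }
  where
  eqF : ∀ {n} → Fin n → Fin n → Bool
  eqF u v = toℕ u ≡ᵇ toℕ v
  eqF-sym : ∀ {n} (u v : Fin n) → eqF u v ≡ eqF v u
  eqF-sym u v = ≡ᵇ-sym (toℕ u) (toℕ v)
    where
    ≡ᵇ-sym : ∀ a b → (a ≡ᵇ b) ≡ (b ≡ᵇ a)
    ≡ᵇ-sym zero zero = refl
    ≡ᵇ-sym zero (suc b) = refl
    ≡ᵇ-sym (suc a) zero = refl
    ≡ᵇ-sym (suc a) (suc b) = ≡ᵇ-sym a b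
  cong₂' : ∀ {a b c d} → a ≡ b → c ≡ d → not (a ∨ c) ≡ not (b ∨ d)
  cong₂' refl refl = refl
  ≡ᵇ-refl : ∀ a → (a ≡ᵇ a) ≡ true
  ≡ᵇ-refl zero = refl
  ≡ᵇ-refl (suc a) = ≡ᵇ-refl a
  irr : ∀ u → not (eqF u u ∨ adj G u u) ≡ false
  irr u with eqF u u | ≡ᵇ-refl (toℕ u)
  ... | .true | refl = refl

Cobipartite : ∀ {n} → Graph n → Set
Cobipartite G = Bipartite (complement G)

_≅_ : ∀ {n m} → Graph n → Graph m → Set
_≅_ {n} {m} G H = Σ (Fin n ⤖ Fin m)
  (λ f → ∀ u v → adj H (Bijection.to f u) (Bijection.to f v) ≡ adj G u v)

-- The exceptional graphs: K₂, P₄ (path 0-1-2-3), C₄ (cycle 0-1-2-3-0),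
-- given by adjacency depending on the difference of vertex indices.
distAdj : ∀ {n} (f : ℕ → Bool) → f 0 ≡ false → Graph n
distAdj f f0 = record
  { adj    = λ u v → f ∣ toℕ u - toℕ v ∣
  ; sym    = λ u v → cong f (∣-∣-comm (toℕ u) (toℕ v))
  ; irrefl = aux
  }
  where
  aux : ∀ {n} (u : Fin n) → f ∣ toℕ u - toℕ u ∣ ≡ false
  aux u rewrite ∣n-n∣≡0 (toℕ u) = f0

K₂ : Graph 2
K₂ = distAdj (λ d → d ≡ᵇ 1) refl

P₄ : Graph 4
P₄ = distAdj (λ d → d ≡ᵇ 1) refl

C₄ : Graph 4
C₄ = distAdj (λ d → (d ≡ᵇ 1) ∨ (d ≡ᵇ 3)) refl

-- Spanning trees are given by a parent map with a depth function decreasing towards the root.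
-- If all leaves of such a tree have the same depth, depth parity properly 2-colours it, so any
-- two leaves are at even distance.  When G has a dominating vertex the star around it works.
-- Otherwise both cliques of G have at least two vertices and there is an edge r s between them;
-- if the class of r has a third vertex, hang s and a second vertex r′ of that class below r,
-- the class of s below s and the class of r below r′: all leaves then have depth 2.  If neither
-- class has a third vertex, G has four vertices and is P₄ or C₄.  Conversely, in a spanning tree
-- of K₂ or P₄ the two ends of the path are leaves, and a spanning tree of C₄ misses an edge whose
-- ends become leaves; in each case the two leaves have different colours in the 2-colouring of
-- the graph, hence lie at odd distance.
module Submission where

open import Defs hiding (sym)
open import Data.Bool using (Bool; true; false; not; _∧_; _∨_; if_then_else_) renaming (_≟_ to _≟ᵇ_)
open import Data.Bool.Properties using (∨-comm; not-involutive; not-injective; not-¬; ¬-not)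
open import Data.Empty using (⊥)
import Data.Fin as Fin
open import Data.Fin using (Fin; toℕ; _≟_) renaming (_<_ to _<ᶠ_)
open import Data.Fin.Properties using (<-cmp; toℕ-injective) renaming (any? to anyᶠ?; all? to allᶠ?)
open import Data.List using (List; []; _∷_; map)
open import Data.List.Membership.Propositional using (_∈_; _∉_)
open import Data.List.Membership.Propositional.Properties using (∈-allFin)
open import Data.List.Relation.Unary.All as All using (All; []; _∷_)
open import Data.List.Relation.Unary.All.Properties using (¬Any⇒All¬; All¬⇒¬Any)
open import Data.List.Relation.Unary.AllPairs using ([]; _∷_)
open import Data.List.Relation.Unary.Any using (here; there; any?)
open import Data.List.Relation.Unary.Unique.Propositional using (Unique)
open import Data.List.Relation.Unary.Unique.Propositional.Properties using (allFin⁺)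
import Data.Nat as ℕ
open import Data.Nat using (ℕ; zero; suc; _+_; _≤_; z≤n; s≤s; ∣_-_∣; _≡ᵇ_)
open import Data.Nat.GeneralisedArithmetic using (iterate)
open import Data.Nat.ListAction using (sum)
open import Data.Nat.Properties using (≤-trans; m≤n+m; +-suc; +-identityʳ; suc-injective; m+1+n≢m; m≢1+m+n)
open import Data.Product using (Σ-syntax; ∃-syntax; _×_; _,_; proj₁; proj₂)
open import Data.Sum using (_⊎_; inj₁; inj₂; [_,_]′; swap; map₂)
open import Data.Vec using (Vec; lookup) renaming ([] to []ᵛ; _∷_ to _∷ᵛ_)
open import Data.Vec.Membership.Propositional using () renaming (_∈_ to _∈ᵛ_)
open import Data.Vec.Relation.Unary.All using ([]; _∷_)
open import Data.Vec.Relation.Unary.AllPairs using ([]; _∷_)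
open import Data.Vec.Relation.Unary.Any using (here; there) renaming (index to indexᵛ)
open import Data.Vec.Relation.Unary.Any.Properties using (lookup-index)
open import Data.Vec.Relation.Unary.Unique.Propositional using () renaming (Unique to Uniqueᵛ)
open import Data.Vec.Relation.Unary.Unique.Propositional.Properties using (lookup-injective)
open import Function using (_∘_; flip; id)
open import Function.Bundles using (mk⤖; Inverse)
open import Function.Properties.Bijection using (⤖⇒↔)
open import Relation.Binary.Definitions using (tri<; tri≈; tri>)
open import Relation.Binary.PropositionalEquality
  using (_≡_; _≢_; refl; sym; trans; cong; cong₂; subst; ≢-sym; module ≡-Reasoning)
open import Relation.Nullary using (¬_; Dec; yes; no; does; contradiction)
open import Relation.Nullary.Decidable using (dec-true; dec-false; ¬?; _×-dec_; _→-dec_)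
open import Relation.Unary using (Decidable)

private
  variable
    m n : ℕ
    G : Graph n
    x y z : Fin n

indicator : Bool → ℕ
indicator b = if b then 1 else 0

module _ {A : Set} (b : A → Bool) where

  count : List A → ℕ
  count l = sum (map (indicator ∘ b) l)

  count-≥1 : ∀ {a l} → a ∈ l → b a ≡ true → 1 ≤ count l
  count-≥1 (here refl) ba rewrite ba = s≤s z≤n
  count-≥1 (there a∈l) ba = ≤-trans (count-≥1 a∈l ba) (m≤n+m _ _)

  count-≥2 : ∀ {a a′ l} → a ∈ l → a′ ∈ l → a ≢ a′ → b a ≡ true → b a′ ≡ true → 2 ≤ count l
  count-≥2 (here refl) (here refl) a≢a′ _ _ = contradiction refl a≢a′
  count-≥2 (here refl) (there a′∈l) _ ba ba′ rewrite ba = s≤s (count-≥1 a′∈l ba′)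
  count-≥2 (there a∈l) (here refl) _ ba ba′ rewrite ba′ = s≤s (count-≥1 a∈l ba)
  count-≥2 (there a∈l) (there a′∈l) a≢a′ ba ba′ = ≤-trans (count-≥2 a∈l a′∈l a≢a′ ba ba′) (m≤n+m _ _)

  count-≡0 : ∀ {l} → All (λ a → b a ≡ false) l → count l ≡ 0
  count-≡0 [] = refl
  count-≡0 (ba ∷ bl) rewrite ba = count-≡0 bl

  count-≡1 : ∀ {a l} → Unique l → a ∈ l → b a ≡ true → (∀ a′ → b a′ ≡ true → a′ ≡ a) → count l ≡ 1
  count-≡1 (a∉l ∷ _) (here refl) ba only rewrite ba =
    cong suc (count-≡0 (All.map (λ a≢a′ → ¬-not (a≢a′ ∘ sym ∘ only _)) a∉l))
  count-≡1 (a′∉l ∷ ul) (there a∈l) ba only rewrite ¬-not (All.lookup a′∉l a∈l ∘ only _) =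
    count-≡1 ul a∈l ba only

two-neighbours⇒¬leaf : (G : Graph n) → x ≢ y → adj G z x ≡ true → adj G z y ≡ true → ¬ IsLeaf G z
two-neighbours⇒¬leaf {x = x} {y} {z} G x≢y zx zy leaf
  with subst (2 ≤_) leaf (count-≥2 (adj G z) (∈-allFin x) (∈-allFin y) x≢y zx zy)
... | s≤s ()

single-neighbour⇒leaf : (G : Graph n) → adj G z x ≡ true → (∀ y → adj G z y ≡ true → y ≡ x) → IsLeaf G z
single-neighbour⇒leaf {z = z} {x} G zx only = count-≡1 (adj G z) (allFin⁺ _) (∈-allFin x) zx only

_++ʷ_ : Walk G x y → Walk G y z → Walk G x z
[] ++ʷ q = q
(e ∷ p) ++ʷ q = e ∷ (p ++ʷ q)

reverseʷ : Walk G x y → Walk G y x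
reverseʷ [] = []
reverseʷ {G = G} (e ∷ p) = reverseʷ p ++ʷ (trans (Graph.sym G _ _) e ∷ [])

head∈verts : (p : Walk G x y) → x ∈ verts p
head∈verts [] = here refl
head∈verts (_ ∷ _) = here refl

last∈verts : (p : Walk G x y) → y ∈ verts p
last∈verts [] = here refl
last∈verts (_ ∷ p) = there (last∈verts p)

first-edge : x ≢ y → Walk G x y → ∃[ w ] adj G x w ≡ true
first-edge x≢y [] = contradiction refl x≢y
first-edge _ (e ∷ _) = _ , e

path-ends-distinct : (p : Walk G x y) → IsPath p → 1 ≤ len p → x ≢ y
path-ends-distinct (_ ∷ p) (x∉p ∷ _) _ refl = All.lookup x∉p (last∈verts p) refl

suffix : (p : Walk G x y) → z ∈ verts p → Σ[ s ∈ Walk G z y ] (IsPath p → IsPath s)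
suffix [] (here refl) = [] , λ u → u
suffix (e ∷ p) (here refl) = e ∷ p , λ u → u
suffix (e ∷ p) (there z∈p) with suffix p z∈p
... | s , sPath = s , λ { (_ ∷ u) → sPath u }

toPath : Walk G x y → Σ[ p ∈ Walk G x y ] IsPath p
toPath [] = [] , [] ∷ []
toPath {x = x} (e ∷ p) with toPath p
... | q , qPath with any? (x ≟_) (verts q)
...   | yes x∈q = proj₁ (suffix q x∈q) , proj₂ (suffix q x∈q) qPath
...   | no x∉q = e ∷ q , ¬Any⇒All¬ _ x∉q ∷ qPath

ProperColouring : Graph n → (Fin n → Bool) → Set
ProperColouring G c = ∀ u v → adj G u v ≡ true → c u ≢ c v

colour-along-walk : ∀ {c} → ProperColouring G c → (p : Walk G x y) → c y ≡ iterate not (c x) (len p)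
colour-along-walk proper [] = refl
colour-along-walk {c = c} proper (e ∷ p) =
  trans (colour-along-walk proper p) (cong (λ b → iterate not b (len p)) (¬-not (≢-sym (proper _ _ e))))

iterate-not-double : ∀ m b → iterate not b (m + m) ≡ b
iterate-not-double zero b = refl
iterate-not-double (suc m) b rewrite +-suc m m = trans (iterate-not-double m (not (not b))) (not-involutive b)

iterate-not-fixed⇒even : ∀ k b → iterate not b k ≡ b → Even k
iterate-not-fixed⇒even zero b _ = 0 , refl
iterate-not-fixed⇒even (suc zero) b e = contradiction (sym e) (not-¬ refl)
iterate-not-fixed⇒even (suc (suc k)) b e rewrite not-involutive b with iterate-not-fixed⇒even k b e
... | m , refl = suc m , cong suc (sym (+-suc m m))

evenWalk⇒sameColour : ∀ {c} → ProperColouring G c → (p : Walk G x y) → Even (len p) → c x ≡ c y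
evenWalk⇒sameColour {x = x} {y} {c = c} proper p (m , len≡m+m) = sym (begin
  c y                             ≡⟨ colour-along-walk proper p ⟩
  iterate not (c x) (len p)       ≡⟨ cong (iterate not (c x)) len≡m+m ⟩
  iterate not (c x) (m + m)       ≡⟨ iterate-not-double m (c x) ⟩
  c x                             ∎)
  where open ≡-Reasoning

sameColour⇒evenWalk : ∀ {c} → ProperColouring G c → (p : Walk G x y) → c x ≡ c y → Even (len p)
sameColour⇒evenWalk proper p cx≡cy =
  iterate-not-fixed⇒even (len p) _ (trans (sym (colour-along-walk proper p)) (sym cx≡cy))

m≢2+m+n : ∀ m {n} → m ≢ suc (suc m) + n
m≢2+m+n m {n} e = m≢1+m+n m (trans e (cong suc (sym (+-suc m n))))

isEven : ℕ → Bool
isEven zero = true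
isEven (suc k) = not (isEven k)

-- The tree whose edges are {v , parent v} for v ≠ root; the depth function certifies that
-- following parents always reaches the root.
module ParentTree (root : Fin n) (parent : Fin n → Fin n) (depth : Fin n → ℕ)
                  (depth-parent : ∀ v → v ≢ root → depth v ≡ suc (depth (parent v))) where

  open ≡-Reasoning

  parent≢ : ∀ v → v ≢ root → parent v ≢ v
  parent≢ v v≢r parent≡v = m≢1+m+n (depth v) (begin
    depth v                      ≡⟨ depth-parent v v≢r ⟩
    suc (depth (parent v))       ≡⟨ cong (suc ∘ depth) parent≡v ⟩
    suc (depth v)                ≡⟨ cong suc (sym (+-identityʳ _)) ⟩
    suc (depth v + 0)            ∎)

  childOf : Fin n → Fin n → Bool
  childOf v u = not (does (v ≟ root)) ∧ does (parent v ≟ u)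

  childOf-true : childOf y x ≡ true → y ≢ root × parent y ≡ x
  childOf-true {y = y} {x} e with y ≟ root | parent y ≟ x
  ... | no y≢r | yes py≡x = y≢r , py≡x

  childOf-parent : ∀ v → v ≢ root → childOf v (parent v) ≡ true
  childOf-parent v v≢r rewrite dec-false (v ≟ root) v≢r = dec-true (parent v ≟ parent v) refl

  childOf-irrefl : ∀ v → childOf v v ≡ false
  childOf-irrefl v with v ≟ root
  ... | yes _ = refl
  ... | no v≢r = dec-false (parent v ≟ v) (parent≢ v v≢r)

  tree : Graph n
  tree = record
    { adj    = λ u v → childOf v u ∨ childOf u v
    ; sym    = λ u v → ∨-comm (childOf v u) (childOf u v)
    ; irrefl = λ v → cong (λ b → b ∨ b) (childOf-irrefl v)
    }

  edge-cases : adj tree x y ≡ true → (y ≢ root × parent y ≡ x) ⊎ (x ≢ root × parent x ≡ y)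
  edge-cases {x = x} {y} e with childOf y x in yx
  ... | true = inj₁ (childOf-true yx)
  ... | false = inj₂ (childOf-true e)

  child-edge : ∀ v → v ≢ root → parent v ≡ x → adj tree x v ≡ true
  child-edge v v≢r refl rewrite childOf-parent v v≢r = refl

  parent-edge : ∀ v → v ≢ root → parent v ≡ x → adj tree v x ≡ true
  parent-edge v v≢r pv≡x = trans (Graph.sym tree v _) (child-edge v v≢r pv≡x)

  spanning : (G : Graph n) → (∀ v → v ≢ root → adj G (parent v) v ≡ true) → SpanningSub tree G
  spanning G parent-adj u v e with edge-cases {x = u} {v} e
  ... | inj₁ (v≢r , refl) = parent-adj v v≢r
  ... | inj₂ (u≢r , refl) = trans (Graph.sym G u (parent u)) (parent-adj u u≢r)

  walkToRoot : ∀ k v → depth v ≡ k → Walk tree v root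
  walkToRoot k v _ with v ≟ root
  ... | yes refl = []
  walkToRoot zero v d≡0 | no v≢r with () ← trans (sym d≡0) (depth-parent v v≢r)
  walkToRoot (suc k) v d≡k | no v≢r =
    parent-edge v v≢r refl ∷ walkToRoot k (parent v) (suc-injective (trans (sym (depth-parent v v≢r)) d≡k))

  connected : Connected tree
  connected u v = walkToRoot _ u refl ++ʷ reverseʷ (walkToRoot _ v refl)

  -- A path entered from the parent of its start can only go down.
  descend : x ≢ root → (p : Walk tree x y) → Unique (parent x ∷ verts p) →
            depth y ≡ depth x + len p × parent y ∈ parent x ∷ verts p
  descend _ [] _ = sym (+-identityʳ _) , here refl
  descend {x = x} x≢r (_∷_ {w = w} e q) (px∉ ∷ u) with edge-cases {x = x} {w} e
  ... | inj₂ (_ , refl) = contradiction refl (All.lookup px∉ (there (head∈verts q)))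
  ... | inj₁ (w≢r , refl) with descend w≢r q u
  ...   | dy , py∈ = trans dy (trans (cong (_+ len q) (depth-parent _ w≢r)) (sym (+-suc _ _))) , there py∈

  ascend : y ≢ root → (p : Walk tree x y) → IsPath p → parent y ∉ verts p → depth x ≡ depth y + len p
  ascend _ [] _ _ = sym (+-identityʳ _)
  ascend {x = x} y≢r (_∷_ {w = w} e q) (x∉q ∷ u) py∉p with edge-cases {x = x} {w} e
  ... | inj₁ (w≢r , refl) = contradiction (proj₂ (descend w≢r q (x∉q ∷ u))) py∉p
  ... | inj₂ (x≢r , refl) =
    trans (depth-parent _ x≢r) (trans (cong suc (ascend y≢r q u (py∉p ∘ there))) (sym (+-suc _ _)))

  -- Each of the first two edges u w, w z of a cycle goes up or down; in all four cases
  -- following the rest of the cycle by descend or ascend contradicts the depths.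
  acyclic : Acyclic tree
  acyclic u (_ ∷ []) (s≤s () , _)
  acyclic u (_ ∷ _ ∷ []) (s≤s (s≤s ()) , _)
  acyclic u (_∷_ {w = w} e₁ (_∷_ {w = z} e₂ q@(_ ∷ _))) (_ , w∉q ∷ qPath)
    with edge-cases {x = u} {w} e₁ | edge-cases {x = w} {z} e₂
  ... | inj₁ (_ , refl) | inj₂ (_ , refl) = path-ends-distinct q qPath (s≤s z≤n) refl
  ... | inj₁ (w≢r , refl) | inj₁ (z≢r , refl) = m≢2+m+n (depth u) (begin
    depth u                              ≡⟨ proj₁ (descend z≢r q (w∉q ∷ qPath)) ⟩
    depth _ + len q                      ≡⟨ cong (_+ len q) (depth-parent _ z≢r) ⟩
    suc (depth _) + len q                ≡⟨ cong (λ d → suc d + len q) (depth-parent _ w≢r) ⟩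
    suc (suc (depth u)) + len q          ∎)
  ... | inj₂ (u≢r , refl) | inj₁ (z≢r , pz≡pu) = m+1+n≢m (depth _) (sym (begin
    depth _                              ≡⟨ depth-parent _ z≢r ⟩
    suc (depth (parent _))               ≡⟨ cong (suc ∘ depth) pz≡pu ⟩
    suc (depth (parent u))               ≡⟨ depth-parent u u≢r ⟨
    depth u                              ≡⟨ proj₁ (descend z≢r q (subst (λ t → Unique (t ∷ verts q)) (sym pz≡pu)
                                                                         (w∉q ∷ qPath))) ⟩
    depth _ + len q                      ∎))
  ... | inj₂ (u≢r , refl) | inj₂ (w≢r , refl) = m≢2+m+n (depth _) (begin
    depth _                              ≡⟨ ascend u≢r q qPath (All¬⇒¬Any w∉q) ⟩
    depth u + len q                      ≡⟨ cong (_+ len q) (depth-parent u u≢r) ⟩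
    suc (depth (parent u)) + len q       ≡⟨ cong (λ d → suc d + len q) (depth-parent _ w≢r) ⟩
    suc (suc (depth _)) + len q          ∎)

  depthParity-proper : ProperColouring tree (isEven ∘ depth)
  depthParity-proper u v e with edge-cases {x = u} {v} e
  ... | inj₁ (v≢r , refl) rewrite depth-parent v v≢r = not-¬ refl
  ... | inj₂ (u≢r , refl) rewrite depth-parent u u≢r = not-¬ refl ∘ sym

  isEvenTree : ∀ k → (∀ v → IsLeaf tree v → depth v ≡ k) → IsEvenTree tree
  isEvenTree k leaf-depth = (connected , acyclic) , λ u v _ u-leaf v-leaf p _ →
    sameColour⇒evenWalk depthParity-proper p
      (cong isEven (trans (leaf-depth u u-leaf) (sym (leaf-depth v v-leaf))))

Dominating : Graph n → Fin n → Set
Dominating G a = ∀ v → v ≢ a → adj G a v ≡ true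

starTree : (G : Graph n) (a : Fin n) → Dominating G a → x ≢ a → y ≢ a → x ≢ y → HasSpanningEvenTree G
starTree {n = n} {x = x} {y} G a dominating x≢a y≢a x≢y =
  tree , spanning G dominating , isEvenTree 1 leaf-depth
  where
  depth : Fin n → ℕ
  depth v = if does (v ≟ a) then 0 else 1

  depth-parent : ∀ v → v ≢ a → depth v ≡ suc (depth a)
  depth-parent v v≢a rewrite dec-false (v ≟ a) v≢a | dec-true (a ≟ a) refl = refl

  open ParentTree a (λ _ → a) depth depth-parent

  a-not-leaf : ¬ IsLeaf tree a
  a-not-leaf = two-neighbours⇒¬leaf tree x≢y (child-edge x x≢a refl) (child-edge y y≢a refl)

  leaf-depth : ∀ v → IsLeaf tree v → depth v ≡ 1
  leaf-depth v leaf rewrite dec-false (v ≟ a) (λ { refl → a-not-leaf leaf }) = refl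

colours-≢⇒≢ : ∀ {c : Fin n → Bool} → c x ≢ c y → x ≢ y
colours-≢⇒≢ cx≢cy refl = cx≢cy refl

≢-both⇒≡ : ∀ {a b c : Bool} → a ≢ c → b ≢ c → a ≡ b
≢-both⇒≡ a≢c b≢c = trans (¬-not a≢c) (sym (¬-not b≢c))

-- Root r with children s and r′; the rest of the colour class of s hangs below s, the rest of
-- the colour class of r below r′.  Every leaf then has depth 2.
module DepthTwoTree (G : Graph n) (c : Fin n → Bool)
  (same-colour⇒adj : ∀ u v → u ≢ v → c u ≡ c v → adj G u v ≡ true)
  {r s r′ r″ s′ : Fin n} (cr≢cs : c r ≢ c s) (rs : adj G r s ≡ true)
  (r′≢r : r′ ≢ r) (cr′≡cr : c r′ ≡ c r) (r″≢r : r″ ≢ r) (r″≢r′ : r″ ≢ r′) (cr″≡cr : c r″ ≡ c r)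
  (s′≢s : s′ ≢ s) (cs′≡cs : c s′ ≡ c s) where

  s≢r : s ≢ r
  s≢r = colours-≢⇒≢ (≢-sym cr≢cs)

  r′≢s : r′ ≢ s
  r′≢s = colours-≢⇒≢ (cr≢cs ∘ trans (sym cr′≡cr))

  lower-parent : Fin n → Fin n
  lower-parent v = if does (c v ≟ᵇ c s) then s else r′

  parent : Fin n → Fin n
  parent v = if does (v ≟ s) ∨ does (v ≟ r′) then r else lower-parent v

  depth : Fin n → ℕ
  depth v = if does (v ≟ r) then 0 else if does (v ≟ s) ∨ does (v ≟ r′) then 1 else 2

  parent-s : parent s ≡ r
  parent-s rewrite dec-true (s ≟ s) refl = refl

  parent-r′ : parent r′ ≡ r
  parent-r′ rewrite dec-false (r′ ≟ s) r′≢s | dec-true (r′ ≟ r′) refl = refl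

  parent-lower : ∀ v → v ≢ s → v ≢ r′ → parent v ≡ lower-parent v
  parent-lower v v≢s v≢r′ rewrite dec-false (v ≟ s) v≢s | dec-false (v ≟ r′) v≢r′ = refl

  lower-parent-cases : ∀ v → (c v ≡ c s × lower-parent v ≡ s) ⊎ (c v ≡ c r × lower-parent v ≡ r′)
  lower-parent-cases v with c v ≟ᵇ c s
  ... | yes cv≡cs = inj₁ (cv≡cs , refl)
  ... | no cv≢cs = inj₂ (≢-both⇒≡ cv≢cs cr≢cs , refl)

  depth-r : depth r ≡ 0
  depth-r rewrite dec-true (r ≟ r) refl = refl

  depth-s : depth s ≡ 1
  depth-s rewrite dec-false (s ≟ r) s≢r | dec-true (s ≟ s) refl = refl

  depth-r′ : depth r′ ≡ 1
  depth-r′ rewrite dec-false (r′ ≟ r) r′≢r | dec-false (r′ ≟ s) r′≢s | dec-true (r′ ≟ r′) refl = refl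

  depth-lower : ∀ v → v ≢ r → v ≢ s → v ≢ r′ → depth v ≡ 2
  depth-lower v v≢r v≢s v≢r′
    rewrite dec-false (v ≟ r) v≢r | dec-false (v ≟ s) v≢s | dec-false (v ≟ r′) v≢r′ = refl

  depth-parent : ∀ v → v ≢ r → depth v ≡ suc (depth (parent v))
  depth-parent v v≢r = by-position (v ≟ s) (v ≟ r′)
    where
    by-position : Dec (v ≡ s) → Dec (v ≡ r′) → depth v ≡ suc (depth (parent v))
    by-position (yes v≡s) _ rewrite v≡s | parent-s | depth-s | depth-r = refl
    by-position (no _) (yes v≡r′) rewrite v≡r′ | parent-r′ | depth-r′ | depth-r = refl
    by-position (no v≢s) (no v≢r′) rewrite parent-lower v v≢s v≢r′ | depth-lower v v≢r v≢s v≢r′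
      with lower-parent-cases v
    ... | inj₁ (_ , p≡s) rewrite p≡s | depth-s = refl
    ... | inj₂ (_ , p≡r′) rewrite p≡r′ | depth-r′ = refl

  parent-adj : ∀ v → v ≢ r → adj G (parent v) v ≡ true
  parent-adj v v≢r = by-position (v ≟ s) (v ≟ r′)
    where
    by-position : Dec (v ≡ s) → Dec (v ≡ r′) → adj G (parent v) v ≡ true
    by-position (yes v≡s) _ rewrite v≡s | parent-s = rs
    by-position (no _) (yes v≡r′) rewrite v≡r′ | parent-r′ = same-colour⇒adj r r′ (≢-sym r′≢r) (sym cr′≡cr)
    by-position (no v≢s) (no v≢r′) rewrite parent-lower v v≢s v≢r′ with lower-parent-cases v
    ... | inj₁ (cv≡cs , p≡s) rewrite p≡s = same-colour⇒adj s v (≢-sym v≢s) (sym cv≡cs)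
    ... | inj₂ (cv≡cr , p≡r′) rewrite p≡r′ = same-colour⇒adj r′ v (≢-sym v≢r′) (trans cr′≡cr (sym cv≡cr))

  open ParentTree r parent depth depth-parent

  s′≢r : s′ ≢ r
  s′≢r = colours-≢⇒≢ (λ cs′≡cr → cr≢cs (trans (sym cs′≡cr) cs′≡cs))

  parent-s′ : parent s′ ≡ s
  parent-s′ rewrite parent-lower s′ s′≢s (colours-≢⇒≢ (λ e → cr≢cs (trans (sym cr′≡cr) (trans (sym e) cs′≡cs))))
    | dec-true (c s′ ≟ᵇ c s) cs′≡cs = refl

  parent-r″ : parent r″ ≡ r′
  parent-r″ rewrite parent-lower r″ (colours-≢⇒≢ (cr≢cs ∘ trans (sym cr″≡cr))) r″≢r′
    | dec-false (c r″ ≟ᵇ c s) (cr≢cs ∘ trans (sym cr″≡cr)) = refl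

  inner-vertex : ∀ v → IsLeaf tree v → v ≢ r × v ≢ s × v ≢ r′
  inner-vertex v leaf =
      (λ v≡r → two-neighbours⇒¬leaf tree (r′≢s ∘ sym)
                 (child-edge s s≢r parent-s) (child-edge r′ r′≢r parent-r′) (subst (IsLeaf tree) v≡r leaf))
    , (λ v≡s → two-neighbours⇒¬leaf tree (s′≢r ∘ sym)
                 (parent-edge s s≢r parent-s) (child-edge s′ s′≢r parent-s′) (subst (IsLeaf tree) v≡s leaf))
    , (λ v≡r′ → two-neighbours⇒¬leaf tree (r″≢r ∘ sym)
                 (parent-edge r′ r′≢r parent-r′) (child-edge r″ r″≢r parent-r″) (subst (IsLeaf tree) v≡r′ leaf))

  evenTree : HasSpanningEvenTree G
  evenTree = tree , spanning G parent-adj , isEvenTree 2 leaf-depth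
    where
    leaf-depth : ∀ v → IsLeaf tree v → depth v ≡ 2
    leaf-depth v leaf with v≢r , v≢s , v≢r′ ← inner-vertex v leaf = depth-lower v v≢r v≢s v≢r′

adj-agree-from-upper : (G : Graph n) (H : Graph m) (w : Fin m → Fin n) →
  (∀ {i j} → i <ᶠ j → adj H i j ≡ adj G (w i) (w j)) → ∀ i j → adj H i j ≡ adj G (w i) (w j)
adj-agree-from-upper G H w upper i j with <-cmp i j
... | tri< i<j _ _ = upper i<j
... | tri≈ _ refl _ = trans (Graph.irrefl H i) (sym (Graph.irrefl G (w i)))
... | tri> _ _ j<i = trans (Graph.sym H i j) (trans (upper j<i) (Graph.sym G (w j) (w i)))

≅-fromEnumeration : (G : Graph n) (H : Graph m) (vs : Vec (Fin n) m) → Uniqueᵛ vs → (∀ v → v ∈ᵛ vs) →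
  (∀ i j → adj H i j ≡ adj G (lookup vs i) (lookup vs j)) → G ≅ H
≅-fromEnumeration G H vs unique covers agree = mk⤖ (to-injective , to-surjective) , to-adj
  where
  to : Fin _ → Fin _
  to v = indexᵛ (covers v)

  lookup-to : ∀ v → lookup vs (to v) ≡ v
  lookup-to v = sym (lookup-index (covers v))

  to-injective : ∀ {u v} → to u ≡ to v → u ≡ v
  to-injective {u} {v} eq = trans (sym (lookup-to u)) (trans (cong (lookup vs) eq) (lookup-to v))

  to-surjective : ∀ i → ∃[ v ] (∀ {u} → u ≡ v → to u ≡ i)
  to-surjective i = lookup vs i , λ { refl → lookup-injective unique _ _ (lookup-to (lookup vs i)) }

  to-adj : ∀ u v → adj H (to u) (to v) ≡ adj G u v
  to-adj u v = trans (agree (to u) (to v)) (cong₂ (adj G) (lookup-to u) (lookup-to v))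

pattern 0F = Fin.zero
pattern 1F = Fin.suc 0F
pattern 2F = Fin.suc 1F
pattern 3F = Fin.suc 2F

≅-fromFour : (G : Graph n) (H : Graph 4) {w₀ w₁ w₂ w₃ : Fin n} →
  Uniqueᵛ (w₀ ∷ᵛ w₁ ∷ᵛ w₂ ∷ᵛ w₃ ∷ᵛ []ᵛ) → (∀ v → v ∈ᵛ w₀ ∷ᵛ w₁ ∷ᵛ w₂ ∷ᵛ w₃ ∷ᵛ []ᵛ) →
  adj H 0F 1F ≡ adj G w₀ w₁ → adj H 0F 2F ≡ adj G w₀ w₂ → adj H 0F 3F ≡ adj G w₀ w₃ →
  adj H 1F 2F ≡ adj G w₁ w₂ → adj H 1F 3F ≡ adj G w₁ w₃ → adj H 2F 3F ≡ adj G w₂ w₃ → G ≅ H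
≅-fromFour G H {w₀} {w₁} {w₂} {w₃} unique covers e₀₁ e₀₂ e₀₃ e₁₂ e₁₃ e₂₃ =
  ≅-fromEnumeration G H vs unique covers (adj-agree-from-upper G H (lookup vs) upper)
  where
  vs : Vec (Fin _) 4
  vs = w₀ ∷ᵛ w₁ ∷ᵛ w₂ ∷ᵛ w₃ ∷ᵛ []ᵛ

  upper : ∀ {i j} → i <ᶠ j → adj H i j ≡ adj G (lookup vs i) (lookup vs j)
  upper {0F} {1F} _ = e₀₁
  upper {0F} {2F} _ = e₀₂
  upper {0F} {3F} _ = e₀₃
  upper {1F} {2F} _ = e₁₂
  upper {1F} {3F} _ = e₁₃
  upper {2F} {3F} _ = e₂₃
  upper {1F} {1F} (s≤s ())
  upper {Fin.suc (Fin.suc _)} {1F} (s≤s ())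
  upper {Fin.suc (Fin.suc _)} {2F} (s≤s (s≤s ()))
  upper {Fin.suc (Fin.suc (Fin.suc _))} {3F} (s≤s (s≤s (s≤s ())))

same-colour⇒adj : (G : Graph n) {c : Fin n → Bool} → ProperColouring (complement G) c →
  ∀ u v → u ≢ v → c u ≡ c v → adj G u v ≡ true
same-colour⇒adj G proper u v u≢v cu≡cv with adj G u v in uv
... | true = refl
... | false = contradiction cu≡cv (proper u v complement-edge)
  where
  -- `does (toℕ u ℕ.≟ toℕ v)` computes to the test `toℕ u ≡ᵇ toℕ v` used by `complement`.
  complement-edge : adj (complement G) u v ≡ true
  complement-edge rewrite uv | dec-false (toℕ u ℕ.≟ toℕ v) (u≢v ∘ toℕ-injective) = refl

dominating? : (G : Graph n) → Dec (∃[ a ] Dominating G a)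
dominating? G = anyᶠ? (λ a → allᶠ? (λ v → ¬? (v ≟ a) →-dec (adj G a v ≟ᵇ true)))

non-neighbour : (G : Graph n) {a : Fin n} → ¬ Dominating G a → ∃[ v ] v ≢ a × adj G a v ≡ false
non-neighbour G {a} ¬dominating with anyᶠ? (λ v → ¬? (v ≟ a) ×-dec (adj G a v ≟ᵇ false))
... | yes found = found
... | no none = contradiction (λ v v≢a → ¬-not (λ av≡false → none (v , v≢a , av≡false))) ¬dominating

third-or-pair : (P : Fin n → Set) → Decidable P → ∀ x y →
  (∃[ v ] P v × v ≢ x × v ≢ y) ⊎ (∀ v → P v → v ≡ x ⊎ v ≡ y)
third-or-pair P P? x y with anyᶠ? (λ v → P? v ×-dec ¬? (v ≟ x) ×-dec ¬? (v ≟ y))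
... | yes third = inj₁ third
... | no none = inj₂ only-two
  where
  only-two : ∀ v → P v → v ≡ x ⊎ v ≡ y
  only-two v pv with v ≟ x | v ≟ y
  ... | yes v≡x | _ = inj₁ v≡x
  ... | no _ | yes v≡y = inj₂ v≡y
  ... | no v≢x | no v≢y = contradiction (v , pv , v≢x , v≢y) none

cross-edge : (c : Fin n → Bool) → Walk G x y → c x ≢ c y → ∃[ a ] ∃[ b ] c a ≢ c b × adj G a b ≡ true
cross-edge c [] cx≢cy = contradiction refl cx≢cy
cross-edge {x = x} c (_∷_ {w = w} e p) cx≢cy with c x ≟ᵇ c w
... | yes cx≡cw = cross-edge c p (cx≢cy ∘ trans cx≡cw)
... | no cx≢cw = x , w , cx≢cw , e

path-or-cycle : (G : Graph n) {a′ a b b′ : Fin n} →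
  Uniqueᵛ (a′ ∷ᵛ a ∷ᵛ b ∷ᵛ b′ ∷ᵛ []ᵛ) → (∀ v → v ∈ᵛ a′ ∷ᵛ a ∷ᵛ b ∷ᵛ b′ ∷ᵛ []ᵛ) →
  adj G a′ a ≡ true → adj G a b ≡ true → adj G b b′ ≡ true → adj G a′ b ≡ false → adj G a b′ ≡ false →
  (G ≅ P₄) ⊎ (G ≅ C₄)
path-or-cycle G {a′} {b′ = b′} unique covers a′a ab bb′ a′b ab′ with adj G a′ b′ in a′b′
... | false = inj₁ (≅-fromFour G P₄ unique covers (sym a′a) (sym a′b) (sym a′b′) (sym ab) (sym ab′) (sym bb′))
... | true  = inj₂ (≅-fromFour G C₄ unique covers (sym a′a) (sym a′b) (sym a′b′) (sym ab) (sym ab′) (sym bb′))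

non-adj⇒colours-≢ : (G : Graph n) {c : Fin n → Bool} → ProperColouring (complement G) c →
  x ≢ y → adj G x y ≡ false → c x ≢ c y
non-adj⇒colours-≢ G proper x≢y xy cx≡cy with () ← trans (sym (same-colour⇒adj G proper _ _ x≢y cx≡cy)) xy

edge-nonedge-≢ : (G : Graph n) → adj G x y ≡ true → adj G x z ≡ false → y ≢ z
edge-nonedge-≢ G xy xz refl with () ← trans (sym xy) xz

module NoDominatingVertex (G : Graph n) (connected : Connected G) {c : Fin n → Bool}
  (proper : ProperColouring (complement G) c) (¬dominating : ∀ a → ¬ Dominating G a) where

  same⇒adj : ∀ u v → u ≢ v → c u ≡ c v → adj G u v ≡ true
  same⇒adj = same-colour⇒adj G proper

  non-neighbour-in-other-class : ∀ a → ∃[ v ] c v ≢ c a × adj G a v ≡ false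
  non-neighbour-in-other-class a with v , v≢a , av ← non-neighbour G (¬dominating a) =
    v , ≢-sym (non-adj⇒colours-≢ G proper (≢-sym v≢a) av) , av

  module _ {a b a′ b′ : Fin n} (ca≢cb : c a ≢ c b) (ab : adj G a b ≡ true)
    (ca′≢cb : c a′ ≢ c b) (ba′ : adj G b a′ ≡ false) (cb′≢ca : c b′ ≢ c a) (ab′ : adj G a b′ ≡ false) where

    ba : adj G b a ≡ true
    ba = trans (Graph.sym G b a) ab

    ca′≡ca : c a′ ≡ c a
    ca′≡ca = ≢-both⇒≡ ca′≢cb ca≢cb

    cb′≡cb : c b′ ≡ c b
    cb′≡cb = ≢-both⇒≡ cb′≢ca (≢-sym ca≢cb)

    a′≢a : a′ ≢ a
    a′≢a = ≢-sym (edge-nonedge-≢ G ba ba′)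

    b′≢b : b′ ≢ b
    b′≢b = ≢-sym (edge-nonedge-≢ G ab ab′)

    distinct : Uniqueᵛ (a′ ∷ᵛ a ∷ᵛ b ∷ᵛ b′ ∷ᵛ []ᵛ)
    distinct = (a′≢a ∷ colours-≢⇒≢ ca′≢cb ∷ colours-≢⇒≢ (ca≢cb ∘ trans (sym ca′≡ca) ∘ flip trans cb′≡cb) ∷ [])
             ∷ (colours-≢⇒≢ ca≢cb ∷ colours-≢⇒≢ (ca≢cb ∘ flip trans cb′≡cb) ∷ [])
             ∷ (≢-sym b′≢b ∷ [])
             ∷ []
             ∷ []

    covers : (∀ v → c v ≡ c a → v ≡ a ⊎ v ≡ a′) → (∀ v → c v ≡ c b → v ≡ b ⊎ v ≡ b′) →
             ∀ v → v ∈ᵛ a′ ∷ᵛ a ∷ᵛ b ∷ᵛ b′ ∷ᵛ []ᵛ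
    covers class-a class-b v with c v ≟ᵇ c a
    ... | yes cv≡ca = [ (λ v≡a → there (here v≡a)) , (λ v≡a′ → here v≡a′) ]′ (class-a v cv≡ca)
    ... | no cv≢ca = [ (λ v≡b → there (there (here v≡b))) , (λ v≡b′ → there (there (there (here v≡b′)))) ]′
                       (class-b v (≢-both⇒≡ cv≢ca (≢-sym ca≢cb)))

    around-cross-edge : HasSpanningEvenTree G ⊎ (G ≅ P₄) ⊎ (G ≅ C₄)
    around-cross-edge with third-or-pair (λ v → c v ≡ c a) (λ v → c v ≟ᵇ c a) a a′
    ... | inj₁ (a″ , ca″≡ca , a″≢a , a″≢a′) =
      inj₁ (DepthTwoTree.evenTree G c same⇒adj ca≢cb ab a′≢a ca′≡ca a″≢a a″≢a′ ca″≡ca b′≢b cb′≡cb)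
    ... | inj₂ class-a with third-or-pair (λ v → c v ≡ c b) (λ v → c v ≟ᵇ c b) b b′
    ...   | inj₁ (b″ , cb″≡cb , b″≢b , b″≢b′) =
      inj₁ (DepthTwoTree.evenTree G c same⇒adj (≢-sym ca≢cb) ba b′≢b cb′≡cb b″≢b b″≢b′ cb″≡cb a′≢a ca′≡ca)
    ...   | inj₂ class-b = inj₂ (path-or-cycle G distinct (covers class-a class-b)
                                  (same⇒adj a′ a a′≢a ca′≡ca) ab (same⇒adj b b′ (≢-sym b′≢b) (sym cb′≡cb))
                                  (trans (Graph.sym G a′ b) ba′) ab′)

  evenTree-or-P₄-or-C₄ : Fin n → HasSpanningEvenTree G ⊎ (G ≅ P₄) ⊎ (G ≅ C₄)
  evenTree-or-P₄-or-C₄ x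
    with y , cy≢cx , _ ← non-neighbour-in-other-class x
    with a , b , ca≢cb , ab ← cross-edge c (connected x y) (≢-sym cy≢cx)
    with b′ , cb′≢ca , ab′ ← non-neighbour-in-other-class a
    with a′ , ca′≢cb , ba′ ← non-neighbour-in-other-class b
    = around-cross-edge ca≢cb ab ca′≢cb ba′ cb′≢ca ab′

connected⇒K₂ : (G : Graph 2) → Connected G → G ≅ K₂
connected⇒K₂ G connected =
  ≅-fromEnumeration G K₂ vs (((λ ()) ∷ []) ∷ [] ∷ []) covers (adj-agree-from-upper G K₂ (lookup vs) upper)
  where
  vs : Vec (Fin 2) 2
  vs = 0F ∷ᵛ 1F ∷ᵛ []ᵛ

  edge : adj G 0F 1F ≡ true
  edge with first-edge (λ ()) (connected 0F 1F)
  ... | 0F , loop with () ← trans (sym loop) (Graph.irrefl G 0F)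
  ... | 1F , e = e

  covers : ∀ v → v ∈ᵛ vs
  covers 0F = here refl
  covers 1F = there (here refl)

  upper : ∀ {i j} → i <ᶠ j → adj K₂ i j ≡ adj G (lookup vs i) (lookup vs j)
  upper {0F} {1F} _ = sym edge
  upper {1F} {1F} (s≤s ())

two-others : ∀ {k} (a : Fin (3 + k)) → ∃[ x ] ∃[ y ] x ≢ a × y ≢ a × x ≢ y
two-others 0F = 1F , 2F , (λ ()) , (λ ()) , (λ ())
two-others 1F = 0F , 2F , (λ ()) , (λ ()) , (λ ())
two-others (Fin.suc (Fin.suc _)) = 0F , 1F , (λ ()) , (λ ()) , (λ ())

evenTree-or-exceptional : (G : Graph n) → 2 ≤ n → Connected G → Cobipartite G →
  HasSpanningEvenTree G ⊎ (G ≅ K₂) ⊎ (G ≅ P₄) ⊎ (G ≅ C₄)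
evenTree-or-exceptional {1} G (s≤s ())
evenTree-or-exceptional {2} G _ connected _ = inj₂ (inj₁ (connected⇒K₂ G connected))
evenTree-or-exceptional {suc (suc (suc _))} G _ connected (_ , proper) with dominating? G
... | yes (a , dominating) with x , y , x≢a , y≢a , x≢y ← two-others a =
  inj₁ (starTree G a dominating x≢a y≢a x≢y)
... | no ¬dominating =
  map₂ inj₂ (NoDominatingVertex.evenTree-or-P₄-or-C₄ G connected proper (λ a → ¬dominating ∘ (a ,_)) 0F)

evenTree-leaves-sameColour : (T : Graph n) {c : Fin n → Bool} → IsEvenTree T → ProperColouring T c →
  x ≢ y → IsLeaf T x → IsLeaf T y → c x ≡ c y
evenTree-leaves-sameColour T ((connected , _) , even) proper x≢y x-leaf y-leaf
  with p , pPath ← toPath (connected _ _) = evenWalk⇒sameColour proper p (even _ _ x≢y x-leaf y-leaf p pPath)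

sole-neighbour⇒leaf : (T : Graph n) → Connected T → x ≢ y → (∀ v → adj T x v ≡ true → v ≡ z) → IsLeaf T x
sole-neighbour⇒leaf T connected x≢y only with w , xw ← first-edge x≢y (connected _ _) =
  single-neighbour⇒leaf T (subst (λ v → adj T _ v ≡ true) (only w xw) xw) only

module Pullback (G : Graph n) (H : Graph m) (iso : G ≅ H) where

  private
    inverse = ⤖⇒↔ (proj₁ iso)

  open Inverse inverse public using (to; from; strictlyInverseˡ; strictlyInverseʳ)

  adj-to : ∀ u v → adj H (to u) (to v) ≡ adj G u v
  adj-to = proj₂ iso

  from-≢ : ∀ {i j} → i ≢ j → from i ≢ from j
  from-≢ {i} {j} i≢j fi≡fj = i≢j (trans (sym (strictlyInverseˡ i)) (trans (cong to fi≡fj) (strictlyInverseˡ j)))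

  to≡⇒≡from : ∀ {z k} → to z ≡ k → z ≡ from k
  to≡⇒≡from {z} tz≡k = trans (sym (strictlyInverseʳ z)) (cong from tz≡k)

  colouring : ∀ {c} → ProperColouring H c → ProperColouring G (c ∘ to)
  colouring proper u v e = proper (to u) (to v) (trans (adj-to u v) e)

  module _ (T : Graph n) (T⊆G : SpanningSub T G) where

    neighbour-image : ∀ {i z} → adj T (from i) z ≡ true → adj H i (to z) ≡ true
    neighbour-image {i} {z} e =
      subst (λ k → adj H k (to z) ≡ true) (strictlyInverseˡ i) (trans (adj-to (from i) z) (T⊆G _ _ e))

    sole-neighbour : ∀ {i j} → (∀ k → adj H i k ≡ true → k ≡ j) → ∀ z → adj T (from i) z ≡ true → z ≡ from j
    sole-neighbour only z e = to≡⇒≡from (only (to z) (neighbour-image e))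

    remaining-neighbour : ∀ {i j j′} → (∀ k → adj H i k ≡ true → k ≡ j ⊎ k ≡ j′) →
      adj T (from i) (from j) ≡ false → ∀ z → adj T (from i) z ≡ true → z ≡ from j′
    remaining-neighbour {i} two missing z e with two (to z) (neighbour-image e)
    ... | inj₂ tz≡j′ = to≡⇒≡from tz≡j′
    ... | inj₁ tz≡j with () ← trans (sym e) (trans (cong (adj T (from i)) (to≡⇒≡from tz≡j)) missing)

    ¬evenTree : ∀ {c i j x′ y′} → ProperColouring H c → IsEvenTree T → i ≢ j → c i ≢ c j →
      (∀ z → adj T (from i) z ≡ true → z ≡ x′) → (∀ z → adj T (from j) z ≡ true → z ≡ y′) → ⊥
    ¬evenTree {c} {i} {j} proper even i≢j ci≢cj only-i only-j = ci≢cj (begin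
      c i                 ≡⟨ cong c (strictlyInverseˡ i) ⟨
      c (to (from i))     ≡⟨ evenTree-leaves-sameColour T even (λ u v e → colouring proper u v (T⊆G u v e))
                               fi≢fj (leaf only-i fi≢fj) (leaf only-j (fi≢fj ∘ sym)) ⟩
      c (to (from j))     ≡⟨ cong c (strictlyInverseˡ j) ⟩
      c j                 ∎)
      where
      open ≡-Reasoning
      fi≢fj = from-≢ i≢j
      leaf : ∀ {u v w} → (∀ z → adj T u z ≡ true → z ≡ w) → u ≢ v → IsLeaf T u
      leaf only u≢v = sole-neighbour⇒leaf T (proj₁ (proj₁ even)) u≢v only

    missing-edge : ∀ {c i j i′ j′} → ProperColouring H c → IsEvenTree T → adj H i j ≡ true →
      (∀ k → adj H i k ≡ true → k ≡ j ⊎ k ≡ i′) → (∀ k → adj H j k ≡ true → k ≡ i ⊎ k ≡ j′) →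
      adj T (from i) (from j) ≡ false → ⊥
    missing-edge {c} proper even ij Ni Nj ij∉T =
      ¬evenTree proper even (colours-≢⇒≢ {c = c} (proper _ _ ij)) (proper _ _ ij)
        (remaining-neighbour Ni ij∉T) (remaining-neighbour Nj (trans (Graph.sym T _ _) ij∉T))

isEven-distance : ∀ i j → isEven ∣ i - j ∣ ≡ false → isEven i ≢ isEven j
isEven-distance zero j odd e with () ← trans e odd
isEven-distance (suc i) zero odd e with () ← trans (sym odd) e
isEven-distance (suc i) (suc j) odd = isEven-distance i j odd ∘ not-injective

distAdj-parity : ∀ {f f0} → (∀ d → f d ≡ true → isEven d ≡ false) →
  ProperColouring (distAdj {n} f f0) (isEven ∘ toℕ)
distAdj-parity odd u v e = isEven-distance (toℕ u) (toℕ v) (odd _ e)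

distance-one : ∀ d → (d ≡ᵇ 1) ≡ true → isEven d ≡ false
distance-one 1 _ = refl

distance-one-or-three : ∀ d → ((d ≡ᵇ 1) ∨ (d ≡ᵇ 3)) ≡ true → isEven d ≡ false
distance-one-or-three 1 _ = refl
distance-one-or-three 3 _ = refl

K₂-parity : ProperColouring K₂ (isEven ∘ toℕ)
K₂-parity = distAdj-parity {f0 = refl} distance-one

P₄-parity : ProperColouring P₄ (isEven ∘ toℕ)
P₄-parity = distAdj-parity {f0 = refl} distance-one

C₄-parity : ProperColouring C₄ (isEven ∘ toℕ)
C₄-parity = distAdj-parity {f0 = refl} distance-one-or-three

K₂-neighbour₀ : ∀ k → adj K₂ 0F k ≡ true → k ≡ 1F
K₂-neighbour₀ 0F ()
K₂-neighbour₀ 1F _ = refl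

K₂-neighbour₁ : ∀ k → adj K₂ 1F k ≡ true → k ≡ 0F
K₂-neighbour₁ 0F _ = refl
K₂-neighbour₁ 1F ()

P₄-neighbour₀ : ∀ k → adj P₄ 0F k ≡ true → k ≡ 1F
P₄-neighbour₀ 0F ()
P₄-neighbour₀ 1F _ = refl
P₄-neighbour₀ 2F ()
P₄-neighbour₀ 3F ()

P₄-neighbour₃ : ∀ k → adj P₄ 3F k ≡ true → k ≡ 2F
P₄-neighbour₃ 0F ()
P₄-neighbour₃ 1F ()
P₄-neighbour₃ 2F _ = refl
P₄-neighbour₃ 3F ()

C₄-neighbour₀ : ∀ k → adj C₄ 0F k ≡ true → k ≡ 1F ⊎ k ≡ 3F
C₄-neighbour₀ 0F ()
C₄-neighbour₀ 1F _ = inj₁ refl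
C₄-neighbour₀ 2F ()
C₄-neighbour₀ 3F _ = inj₂ refl

C₄-neighbour₁ : ∀ k → adj C₄ 1F k ≡ true → k ≡ 0F ⊎ k ≡ 2F
C₄-neighbour₁ 0F _ = inj₁ refl
C₄-neighbour₁ 1F ()
C₄-neighbour₁ 2F _ = inj₂ refl
C₄-neighbour₁ 3F ()

C₄-neighbour₂ : ∀ k → adj C₄ 2F k ≡ true → k ≡ 1F ⊎ k ≡ 3F
C₄-neighbour₂ 0F ()
C₄-neighbour₂ 1F _ = inj₁ refl
C₄-neighbour₂ 2F ()
C₄-neighbour₂ 3F _ = inj₂ refl

C₄-neighbour₃ : ∀ k → adj C₄ 3F k ≡ true → k ≡ 0F ⊎ k ≡ 2F
C₄-neighbour₃ 0F _ = inj₁ refl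
C₄-neighbour₃ 1F ()
C₄-neighbour₃ 2F _ = inj₂ refl
C₄-neighbour₃ 3F ()

K₂-¬evenTree : (G : Graph n) → G ≅ K₂ → ¬ HasSpanningEvenTree G
K₂-¬evenTree G iso (T , T⊆G , even) =
  ¬evenTree T T⊆G {i = 0F} {1F} K₂-parity even (λ ()) (λ ())
    (sole-neighbour T T⊆G K₂-neighbour₀) (sole-neighbour T T⊆G K₂-neighbour₁)
  where open Pullback G K₂ iso

P₄-¬evenTree : (G : Graph n) → G ≅ P₄ → ¬ HasSpanningEvenTree G
P₄-¬evenTree G iso (T , T⊆G , even) =
  ¬evenTree T T⊆G {i = 0F} {3F} P₄-parity even (λ ()) (λ ())
    (sole-neighbour T T⊆G P₄-neighbour₀) (sole-neighbour T T⊆G P₄-neighbour₃)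
  where open Pullback G P₄ iso

-- A spanning tree of C₄ misses one of its edges, whose ends are then leaves of different colours.
module _ (G : Graph n) (iso : G ≅ C₄) where

  open Pullback G C₄ iso

  C₄-¬evenTree : ¬ HasSpanningEvenTree G
  C₄-¬evenTree (T , T⊆G , even@((_ , acyclic) , _))
    with adj T (from 0F) (from 1F) in e₀₁ | adj T (from 1F) (from 2F) in e₁₂
       | adj T (from 2F) (from 3F) in e₂₃ | adj T (from 3F) (from 0F) in e₃₀
  ... | false | _ | _ | _ =
    missing-edge T T⊆G {i = 0F} {1F} C₄-parity even refl C₄-neighbour₀ C₄-neighbour₁ e₀₁
  ... | true | false | _ | _ =
    missing-edge T T⊆G {i = 1F} {2F} C₄-parity even refl (λ k → swap ∘ C₄-neighbour₁ k) C₄-neighbour₂ e₁₂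
  ... | true | true | false | _ =
    missing-edge T T⊆G {i = 2F} {3F} C₄-parity even refl
      (λ k → swap ∘ C₄-neighbour₂ k) (λ k → swap ∘ C₄-neighbour₃ k) e₂₃
  ... | true | true | true | false =
    missing-edge T T⊆G {i = 3F} {0F} C₄-parity even refl C₄-neighbour₃ (λ k → swap ∘ C₄-neighbour₀ k) e₃₀
  ... | true | true | true | true =
    acyclic (from 0F) (e₀₁ ∷ e₁₂ ∷ e₂₃ ∷ e₃₀ ∷ []) (s≤s (s≤s (s≤s z≤n)) , distinct)
    where
    distinct : Unique (from 1F ∷ from 2F ∷ from 3F ∷ from 0F ∷ [])
    distinct = (from-≢ (λ ()) ∷ from-≢ (λ ()) ∷ from-≢ (λ ()) ∷ [])
             ∷ (from-≢ (λ ()) ∷ from-≢ (λ ()) ∷ [])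
             ∷ (from-≢ (λ ()) ∷ [])
             ∷ []
             ∷ []

exceptional⇒¬evenTree : (G : Graph n) → (G ≅ K₂) ⊎ (G ≅ P₄) ⊎ (G ≅ C₄) → ¬ HasSpanningEvenTree G
exceptional⇒¬evenTree G = [ K₂-¬evenTree G , [ P₄-¬evenTree G , C₄-¬evenTree G ]′ ]′

theorem6 : ∀ (n : ℕ) (G : Graph n) → 2 ≤ n → Connected G → Cobipartite G →
    (¬ ((G ≅ K₂) ⊎ (G ≅ P₄) ⊎ (G ≅ C₄)) → HasSpanningEvenTree G)
    × (((G ≅ K₂) ⊎ (G ≅ P₄) ⊎ (G ≅ C₄)) → ¬ HasSpanningEvenTree G)
theorem6 n G 2≤n connected cobipartite =
    (λ ¬exceptional → [ id , flip contradiction ¬exceptional ]′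
                        (evenTree-or-exceptional G 2≤n connected cobipartite))
  , exceptional⇒¬evenTree G
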